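{- Let $F$ be a graph with a cut-edge $e$ such that $G$ and $H$ are the components of $F-e$. If $k$ is an integer with $2\leq k<\min\{\delta(G),\delta(H)\}$, then \[ \gamma_{\times k,t}(G_I)+\gamma_{\times k,t}(H_I)-2\leq \gamma_{\times k,t}(F_I)\leq \gamma_{\times k,t}(G_I)+\gamma_{\times k,t}(H_I). \]
   Context: All graphs are finite, simple and undirected. For a graph $G$ without isolated vertices, the inflated graph $G_I$ is obtained as follows: each vertex $x_i$ of $G$ of degree $d(x_i)$ is replaced by a clique $X_i\cong K_{d(x_i)}$ whose vertices are labelled $x_ix_j$, one for each neighbour $x_j$ of $x_i$; and each edge $x_ix_j$ of $G$ is replaced by the edge joining $x_ix_j\in X_i$ to $x_jx_i\in X_j$. For an integer $k\geq1$, a set $S\subseteq V(H)$ is a $k$-tuple total dominating set of a graph $H$ if every vertex of $H$ has at least $k$ neighbours in $S$; $\gamma_{\times k,t}(H)$ denotes the minimum cardinality of such a set. -}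

module Defs where

open import Data.Bool using (Bool; true; false; T; _∧_; _∨_; not)
open import Data.Nat using (ℕ; zero; suc; _≤_; _⊓_)
open import Data.Fin using (Fin; zero; suc)
import Data.Fin as Fin
open import Data.Sum using (_⊎_; inj₁; inj₂)
open import Data.Sum.Properties using (≡-dec)
open import Data.Product using (Σ; Σ-syntax; _×_; _,_; proj₁; proj₂)
open import Data.List using (List; length; filterᵇ; allFin)
open import Data.List.Relation.Unary.Unique.Propositional using (Unique)
open import Relation.Binary.PropositionalEquality using (_≡_)
open import Relation.Binary.Definitions using (DecidableEquality)
open import Relation.Nullary.Decidable using (⌊_⌋)
open import Function using (_∘_)

record Graph (V : Set) : Set where
  field
    adj    : V → V → Bool
    sym    : ∀ x y → adj x y ≡ adj y x
    irrefl : ∀ x → adj x x ≡ false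

open Graph public

degree : ∀ {n} → Graph (Fin n) → Fin n → ℕ
degree {n} G x = length (filterᵇ (adj G x) (allFin n))

minOver : ∀ {n} → (Fin (suc n) → ℕ) → ℕ
minOver {zero}  f = f zero
minOver {suc n} f = f zero ⊓ minOver (f ∘ suc)

δ : ∀ {n} → Graph (Fin (suc n)) → ℕ
δ G = minOver (degree G)

data Reachable {V : Set} (adj : V → V → Bool) : V → V → Set where
  here : ∀ {x} → Reachable adj x x
  step : ∀ {x y z} → T (adj x y) → Reachable adj y z → Reachable adj x z

Connected : ∀ {V} → Graph V → Set
Connected {V} G = ∀ (x y : V) → Reachable (adj G) x y

-- The graph F: disjoint union of G and H plus the edge e = u v.
-- Then e is a cut-edge of F and G, H are the components of F - e
-- (whenever G and H are connected).

joinAdj : ∀ {A B : Set} → DecidableEquality A → DecidableEquality B →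
          Graph A → Graph B → A → B → A ⊎ B → A ⊎ B → Bool
joinAdj _ _ G H u v (inj₁ a) (inj₁ b) = adj G a b
joinAdj _ _ G H u v (inj₂ a) (inj₂ b) = adj H a b
joinAdj eqA eqB G H u v (inj₁ a) (inj₂ b) = ⌊ eqA a u ⌋ ∧ ⌊ eqB b v ⌋
joinAdj eqA eqB G H u v (inj₂ b) (inj₁ a) = ⌊ eqA a u ⌋ ∧ ⌊ eqB b v ⌋

-- Vertices: ordered pairs (x_i , x_j) with x_i x_j
-- an edge (vertex x_i x_j of the clique X_i).  x_i x_j ~ x_i' x_j' iff
-- (i = i' and j ≠ j')  [inside clique X_i]   or
-- (i = j' and j = i')  [the edge replacing x_i x_j].

IV : ∀ {V : Set} → (V → V → Bool) → Set
IV {V} adj = Σ[ p ∈ V × V ] T (adj (proj₁ p) (proj₂ p))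

inflAdj : ∀ {V : Set} → DecidableEquality V → (adj : V → V → Bool) →
          IV adj → IV adj → Bool
inflAdj _≟_ adj ((i , j) , _) ((i' , j') , _) =
  (⌊ i ≟ i' ⌋ ∧ not ⌊ j ≟ j' ⌋) ∨ (⌊ i ≟ j' ⌋ ∧ ⌊ j ≟ i' ⌋)

-- k-tuple total domination.  A vertex set S is a duplicate-free list;
-- |S| = length S.

IsKTupleTDS : ∀ {W : Set} → (W → W → Bool) → ℕ → List W → Set
IsKTupleTDS {W} adj k S = Unique S × (∀ (w : W) → k ≤ length (filterᵇ (adj w) S))

IsGammaKT : ∀ {W : Set} → (W → W → Bool) → ℕ → ℕ → Set
IsGammaKT {W} adj k m =
  (Σ[ S ∈ List W ] (IsKTupleTDS adj k S × length S ≡ m)) ×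
  (∀ (S : List W) → IsKTupleTDS adj k S → m ≤ length S)

inflated : ∀ {n} → (G : Graph (Fin n)) → IV (adj G) → IV (adj G) → Bool
inflated G = inflAdj Fin._≟_ (adj G)

FAdj : ∀ {m p} → Graph (Fin m) → Graph (Fin p) → Fin m → Fin p →
       Fin m ⊎ Fin p → Fin m ⊎ Fin p → Bool
FAdj G H u v = joinAdj Fin._≟_ Fin._≟_ G H u v

inflatedF : ∀ {m p} (G : Graph (Fin m)) (H : Graph (Fin p)) (u : Fin m) (v : Fin p) →
            IV (FAdj G H u v) → IV (FAdj G H u v) → Bool
inflatedF G H u v = inflAdj (≡-dec Fin._≟_ Fin._≟_) (FAdj G H u v)

module Submission where

-- F_I consists of a copy of G_I, a copy of H_I, and the vertices e_u = uv ∈ X_u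
-- and e_v = vu ∈ X_v, adjacent to each other and to the copies of X_u, resp. X_v.
-- Every clique X_c of G_I has deg(c) > k vertices, so (k ≥ 2) every k-tuple total
-- dominating set (TDS) of G_I meets X_u in ≥ k vertices.
-- * Upper bound: the union of k-tuple TDSs of G_I and H_I is one of F_I; e_u and
--   e_v are dominated through X_u and X_v.
-- * Lower bound: restricting a k-tuple TDS S of F_I to G_I loses at most the
--   neighbour e_u, and only for vertices of X_u; when e_u ∈ S adding two vertices of
--   X_u repairs this.  So γ(G_I) ≤ |S ∩ G_I| + 2[e_u ∈ S], similarly for H, and
--   summing gives γ(G_I) + γ(H_I) ≤ |S| + 2.

open import Data.Bool using (Bool; true; false; T; _∧_; _∨_; not)
open import Data.Bool.Properties using (T-irrelevant; T-∨; T-∧)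
open import Data.Nat using (ℕ; zero; suc; _≤_; _<_; _+_; _*_; _∸_; _⊓_; z≤n; s≤s; _≤?_)
open import Data.Nat.Properties
open import Data.Nat.Tactic.RingSolver using (solve-∀)
open import Data.Fin using (Fin)
import Data.Fin as Fin
open import Data.List
  using (List; []; _∷_; _++_; length; filter; filterᵇ; map; mapMaybe; deduplicate; cartesianProduct; allFin)
open import Data.List.Properties using (length-++; length-map; filter-++)
open import Data.List.Membership.Propositional using (_∈_; _∉_)
open import Data.List.Membership.Propositional.Properties
  using ( ∈-∃++; ∈-filter⁺; ∈-filter⁻; ∈-map⁺; ∈-map⁻; ∈-++⁺ˡ; ∈-++⁺ʳ
        ; ∈-deduplicate⁺; ∈-allFin; ∈-cartesianProduct⁺)
open import Data.List.Relation.Unary.Any using (here; there)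
import Data.List.Relation.Unary.Any as Any
open import Data.List.Relation.Unary.Any.Properties using (mapMaybe⁺; map⁺)
open import Data.List.Relation.Unary.All using (All; []; _∷_)
import Data.List.Relation.Unary.All as All
open import Data.List.Relation.Unary.All.Properties using (¬Any⇒All¬)
open import Data.List.Relation.Unary.Unique.Propositional using (Unique; []; _∷_)
import Data.List.Relation.Unary.Unique.Propositional.Properties as Unique
open import Data.List.Extrema.Nat using (argmin; argmin-all; f[argmin]≤f[xs])
open import Data.Maybe using (Maybe; just; nothing; maybe′; is-just)
open import Data.Maybe.Properties using (just-injective)
import Data.Maybe.Relation.Unary.Any as MaybeAny
open import Data.Product using (Σ; Σ-syntax; _×_; _,_; proj₁; proj₂)
open import Data.Product.Properties using () renaming (≡-dec to Σ-≡-dec)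
open import Data.Sum using (_⊎_; inj₁; inj₂; [_,_]′)
import Data.Sum as Sum
open import Data.Sum.Properties using (inj₁-injective; inj₂-injective) renaming (≡-dec to ⊎-≡-dec)
open import Data.Empty using (⊥-elim)
open import Data.Unit using (tt)
open import Function using (_∘_)
open import Function.Bundles using (Equivalence)
open import Relation.Binary.PropositionalEquality
open import Relation.Binary.Definitions using (DecidableEquality)
open import Relation.Nullary using (¬_; yes; no; Dec)
open import Relation.Nullary.Decidable using (⌊_⌋; T?; toWitness; fromWitness; _×-dec_; ¬?; map′; ⌊⌋-map′)

open import Defs hiding (sym)

count : ∀ {A : Set} → (A → Bool) → List A → ℕ
count p xs = length (filterᵇ p xs)

T-∨-intro : ∀ a {b} → T a ⊎ T b → T (a ∨ b)
T-∨-intro a = Equivalence.from (T-∨ {a})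

except : ∀ {A : Set} → DecidableEquality A → (A → Bool) → A → A → Bool
except _≟_ p s t = p t ∧ not ⌊ t ≟ s ⌋

module _ {A : Set} (_≟_ : DecidableEquality A) (p : A → Bool) {s t : A} where

  except-intro : T (p t) → t ≢ s → T (except _≟_ p s t)
  except-intro pt t≢s with p t | t ≟ s
  ... | true | no _     = tt
  ... | true | yes t≡s  = t≢s t≡s

  except-elim : T (except _≟_ p s t) → T (p t) × t ≢ s
  except-elim ept with p t | t ≟ s
  ... | true | no t≢s = tt , t≢s

module _ {A : Set} where

  count-++ : ∀ (p : A → Bool) xs ys → count p (xs ++ ys) ≡ count p xs + count p ys
  count-++ p xs ys = trans (cong length (filter-++ (T? ∘ p) xs ys)) (length-++ (filterᵇ p xs))

  count-≤-++ˡ : ∀ (p : A → Bool) xs ys → count p xs ≤ count p (xs ++ ys)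
  count-≤-++ˡ p xs ys = subst (count p xs ≤_) (sym (count-++ p xs ys)) (m≤m+n _ _)

  count-≤-++ʳ : ∀ (p : A → Bool) xs ys → count p ys ≤ count p (xs ++ ys)
  count-≤-++ʳ p xs ys = subst (count p ys ≤_) (sym (count-++ p xs ys)) (m≤n+m _ _)

  count-mono : ∀ (p q : A → Bool) xs → (∀ x → x ∈ xs → T (p x) → T (q x)) →
               count p xs ≤ count q xs
  count-mono p q [] _ = z≤n
  count-mono p q (x ∷ xs) p⇒q with p x in px | q x in qx
  ... | true  | true  = s≤s (count-mono p q xs (λ y y∈ → p⇒q y (there y∈)))
  ... | false | true  = m≤n⇒m≤1+n (count-mono p q xs (λ y y∈ → p⇒q y (there y∈)))
  ... | false | false = count-mono p q xs (λ y y∈ → p⇒q y (there y∈))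
  ... | true  | false = ⊥-elim (subst T qx (p⇒q x (here refl) (subst T (sym px) tt)))

  count-≤-length : ∀ (p : A → Bool) xs → count p xs ≤ length xs
  count-≤-length p [] = z≤n
  count-≤-length p (x ∷ xs) with p x
  ... | true  = s≤s (count-≤-length p xs)
  ... | false = m≤n⇒m≤1+n (count-≤-length p xs)

  count-∨ : ∀ (p q : A → Bool) xs → count (λ x → p x ∨ q x) xs ≤ count p xs + count q xs
  count-∨ p q [] = z≤n
  count-∨ p q (x ∷ xs) with p x | q x
  ... | true  | true  = s≤s (≤-trans (count-∨ p q xs) (+-monoʳ-≤ (count p xs) (n≤1+n _)))
  ... | true  | false = s≤s (count-∨ p q xs)
  ... | false | true  = ≤-trans (s≤s (count-∨ p q xs)) (≤-reflexive (sym (+-suc (count p xs) (count q xs))))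
  ... | false | false = count-∨ p q xs

  count-disjoint : ∀ (p q : A → Bool) xs → (∀ x → T (p x) → ¬ T (q x)) →
                   count p xs + count q xs ≤ count (λ x → p x ∨ q x) xs
  count-disjoint p q [] _ = z≤n
  count-disjoint p q (x ∷ xs) disj with p x in px | q x in qx
  ... | true  | true  = ⊥-elim (disj x (subst T (sym px) tt) (subst T (sym qx) tt))
  ... | true  | false = s≤s (count-disjoint p q xs disj)
  ... | false | true  = ≤-trans (≤-reflexive (+-suc (count p xs) (count q xs))) (s≤s (count-disjoint p q xs disj))
  ... | false | false = count-disjoint p q xs disj

  count-witness : ∀ (p : A → Bool) xs → 0 < count p xs → Σ[ x ∈ A ] (x ∈ xs × T (p x))
  count-witness p (x ∷ xs) pos with p x in px
  ... | true  = x , here refl , subst T (sym px) tt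
  ... | false with count-witness p xs pos
  ... | y , y∈ , py = y , there y∈ , py

  count-≥1 : ∀ (p : A → Bool) xs {x} → x ∈ xs → T (p x) → 1 ≤ count p xs
  count-≥1 p xs x∈ px with filterᵇ p xs | ∈-filter⁺ (T? ∘ p) x∈ px
  ... | _ ∷ _ | _ = s≤s z≤n

  count-≤1 : ∀ (p : A → Bool) xs → Unique xs → (∀ x y → T (p x) → T (p y) → x ≡ y) →
             count p xs ≤ 1
  count-≤1 p [] _ _ = z≤n
  count-≤1 p (x ∷ xs) (x∉ ∷ uxs) one with p x in px
  ... | true  = s≤s (≤-reflexive (none xs x∉))
    where
    none : ∀ ys → All (x ≢_) ys → count p ys ≡ 0
    none [] _ = refl
    none (y ∷ ys) (x≢y ∷ rest) with p y in py
    ... | true  = ⊥-elim (x≢y (one x y (subst T (sym px) tt) (subst T (sym py) tt)))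
    ... | false = none ys rest
  ... | false = count-≤1 p xs uxs one

  count-map : ∀ {B : Set} (p : B → Bool) (f : A → B) xs → count p (map f xs) ≡ count (p ∘ f) xs
  count-map p f [] = refl
  count-map p f (x ∷ xs) with p (f x)
  ... | true  = cong suc (count-map p f xs)
  ... | false = count-map p f xs

  unique-⊆-length : ∀ (xs ys : List A) → Unique xs → (∀ x → x ∈ xs → x ∈ ys) → length xs ≤ length ys
  unique-⊆-length [] ys _ _ = z≤n
  unique-⊆-length (x ∷ xs) ys (x∉ ∷ uxs) xs⊆ys with ∈-∃++ (xs⊆ys x (here refl))
  ... | as , bs , refl = begin
      suc (length xs)            ≤⟨ s≤s (unique-⊆-length xs (as ++ bs) uxs xs⊆as++bs) ⟩
      suc (length (as ++ bs))    ≡⟨ cong suc (length-++ as) ⟩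
      suc (length as + length bs) ≡⟨ +-suc (length as) _ ⟨
      length as + length (x ∷ bs) ≡⟨ length-++ as ⟨
      length (as ++ x ∷ bs)      ∎
    where
    open ≤-Reasoning
    drop-x : ∀ {y} cs → y ∈ cs ++ x ∷ bs → y ≢ x → y ∈ cs ++ bs
    drop-x []       (here refl) y≢x = ⊥-elim (y≢x refl)
    drop-x []       (there y∈)  _   = y∈
    drop-x (c ∷ cs) (here refl) _   = here refl
    drop-x (c ∷ cs) (there y∈)  y≢x = there (drop-x cs y∈ y≢x)
    xs⊆as++bs : ∀ y → y ∈ xs → y ∈ as ++ bs
    xs⊆as++bs y y∈ = drop-x as (xs⊆ys y (there y∈)) (λ y≡x → All.lookup x∉ y∈ (sym y≡x))

  count-⊆ : ∀ (p : A → Bool) xs ys → Unique xs → (∀ x → x ∈ xs → x ∈ ys) → count p xs ≤ count p ys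
  count-⊆ p xs ys uxs xs⊆ys =
    unique-⊆-length (filterᵇ p xs) (filterᵇ p ys) (Unique.filter⁺ (T? ∘ p) uxs) λ x x∈ →
      let x∈xs , px = ∈-filter⁻ (T? ∘ p) x∈ in ∈-filter⁺ (T? ∘ p) (xs⊆ys x x∈xs) px

  module _ (_≟_ : DecidableEquality A) where

    occurrences-≤1 : ∀ s xs → Unique xs → count (λ t → ⌊ t ≟ s ⌋) xs ≤ 1
    occurrences-≤1 s xs uxs = count-≤1 _ xs uxs λ x y x≡s y≡s → trans (toWitness x≡s) (sym (toWitness y≡s))

    count-except-≤ : ∀ (p : A → Bool) s xs → Unique xs → count p xs ≤ suc (count (except _≟_ p s) xs)
    count-except-≤ p s xs uxs = begin
      count p xs                                          ≤⟨ count-mono p _ xs split ⟩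
      count (λ t → except _≟_ p s t ∨ ⌊ t ≟ s ⌋) xs       ≤⟨ count-∨ _ _ xs ⟩
      count (except _≟_ p s) xs + count (λ t → ⌊ t ≟ s ⌋) xs
        ≤⟨ +-monoʳ-≤ _ (occurrences-≤1 s xs uxs) ⟩
      count (except _≟_ p s) xs + 1                       ≡⟨ +-comm _ 1 ⟩
      suc (count (except _≟_ p s) xs)                     ∎
      where
      open ≤-Reasoning
      split : ∀ t → t ∈ xs → T (p t) → T (except _≟_ p s t ∨ ⌊ t ≟ s ⌋)
      split t _ pt with p t | t ≟ s
      ... | true | yes _ = tt
      ... | true | no _  = tt

    count-except-< : ∀ (p : A → Bool) s xs → Unique xs → s ∈ xs → T (p s) →
                     suc (count (except _≟_ p s) xs) ≤ count p xs
    count-except-< p s (x ∷ xs) (x∉ ∷ uxs) (here refl) ps with p x | x ≟ x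
    ... | true  | yes _ = s≤s (count-mono _ p xs λ _ _ → proj₁ ∘ except-elim _≟_ p)
    ... | true  | no x≢x = ⊥-elim (x≢x refl)
    count-except-< p s (x ∷ xs) (x∉ ∷ uxs) (there s∈) ps with x ≟ s
    ... | yes refl = ⊥-elim (All.lookup x∉ s∈ refl)
    ... | no _ with p x
    ... | true  = s≤s (count-except-< p s xs uxs s∈ ps)
    ... | false = count-except-< p s xs uxs s∈ ps

module _ {A B : Set} (f : A → Maybe B) where

  count-mapMaybe : ∀ (q : B → Bool) xs → count q (mapMaybe f xs) ≡ count (maybe′ q false ∘ f) xs
  count-mapMaybe q [] = refl
  count-mapMaybe q (x ∷ xs) with f x
  ... | nothing = count-mapMaybe q xs
  ... | just y with q y
  ... | true  = cong suc (count-mapMaybe q xs)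
  ... | false = count-mapMaybe q xs

  length-mapMaybe : ∀ xs → length (mapMaybe f xs) ≡ count (is-just ∘ f) xs
  length-mapMaybe [] = refl
  length-mapMaybe (x ∷ xs) with f x
  ... | nothing = length-mapMaybe xs
  ... | just _  = cong suc (length-mapMaybe xs)

  ∈-mapMaybe⁻ : ∀ xs {y} → y ∈ mapMaybe f xs → Σ[ x ∈ A ] (x ∈ xs × f x ≡ just y)
  ∈-mapMaybe⁻ (x ∷ xs) y∈ with f x in fx
  ... | nothing = let w , w∈ , fw = ∈-mapMaybe⁻ xs y∈ in w , there w∈ , fw
  ∈-mapMaybe⁻ (x ∷ xs) (here refl) | just _ = x , here refl , fx
  ∈-mapMaybe⁻ (x ∷ xs) (there y∈)  | just _ = let w , w∈ , fw = ∈-mapMaybe⁻ xs y∈ in w , there w∈ , fw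

  mapMaybe-unique : (∀ {x x′ y} → f x ≡ just y → f x′ ≡ just y → x ≡ x′) →
                    ∀ xs → Unique xs → Unique (mapMaybe f xs)
  mapMaybe-unique inj [] [] = []
  mapMaybe-unique inj (x ∷ xs) (x∉ ∷ uxs) with f x in fx
  ... | nothing = mapMaybe-unique inj xs uxs
  ... | just y  = All.tabulate new ∷ mapMaybe-unique inj xs uxs
    where
    new : ∀ {z} → z ∈ mapMaybe f xs → y ≢ z
    new z∈ refl = let w , w∈ , fw = ∈-mapMaybe⁻ xs z∈ in All.lookup x∉ w∈ (inj fx fw)

sublists : ∀ {A : Set} → List A → List (List A)
sublists []       = [] ∷ []
sublists (x ∷ xs) = map (x ∷_) (sublists xs) ++ sublists xs

filter-∈-sublists : ∀ {A : Set} (p : A → Bool) xs → filterᵇ p xs ∈ sublists xs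
filter-∈-sublists p [] = here refl
filter-∈-sublists p (x ∷ xs) with p x
... | true  = ∈-++⁺ˡ (∈-map⁺ (x ∷_) (filter-∈-sublists p xs))
... | false = ∈-++⁺ʳ (map (x ∷_) (sublists xs)) (filter-∈-sublists p xs)

-- Over a finite vertex type, γ_{×k,t} exists as soon as some k-tuple total
-- dominating set does: every such set can be normalised to a sublist of a fixed
-- enumeration of the vertices with the same size, and among the finitely many
-- sublists that are k-tuple total dominating sets we take one of least length.
module FiniteMinimum {W : Set} (_≟_ : DecidableEquality W)
                     (enum : List W) (complete : ∀ w → w ∈ enum) where
  open import Data.List.Membership.DecPropositional _≟_ using (_∈?_)
  open import Data.List.Relation.Unary.Unique.DecPropositional _≟_ using (unique?)
  open import Data.List.Relation.Unary.Unique.DecPropositional.Properties _≟_ using (deduplicate-!)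

  vertices : List W
  vertices = deduplicate _≟_ enum

  vertices-unique : Unique vertices
  vertices-unique = deduplicate-! enum

  vertices-complete : ∀ w → w ∈ vertices
  vertices-complete w = ∈-deduplicate⁺ _≟_ (complete w)

  normalise : List W → List W
  normalise S = filterᵇ (λ w → ⌊ w ∈? S ⌋) vertices

  private
    normalise-unique : ∀ S → Unique (normalise S)
    normalise-unique S = Unique.filter⁺ (T? ∘ λ w → ⌊ w ∈? S ⌋) vertices-unique

    normalise-⊆ : ∀ S x → x ∈ normalise S → x ∈ S
    normalise-⊆ S x x∈ = toWitness (proj₂ (∈-filter⁻ (T? ∘ λ w → ⌊ w ∈? S ⌋) {xs = vertices} x∈))

    normalise-⊇ : ∀ S x → x ∈ S → x ∈ normalise S
    normalise-⊇ S x x∈ = ∈-filter⁺ (T? ∘ λ w → ⌊ w ∈? S ⌋) (vertices-complete x) (fromWitness x∈)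

  normalise-length : ∀ S → Unique S → length (normalise S) ≡ length S
  normalise-length S uS = ≤-antisym
    (unique-⊆-length (normalise S) S (normalise-unique S) (normalise-⊆ S))
    (unique-⊆-length S (normalise S) uS (normalise-⊇ S))

  normalise-TDS : ∀ adjW k S → IsKTupleTDS adjW k S → IsKTupleTDS adjW k (normalise S)
  normalise-TDS adjW k S (uS , dom) = normalise-unique S , λ w → ≤-trans (dom w)
    (count-⊆ (adjW w) S (normalise S) uS (normalise-⊇ S))

  isTDS? : ∀ adjW k S → Dec (IsKTupleTDS adjW k S)
  isTDS? adjW k S with unique? S | All.all? (λ w → k ≤? count (adjW w) S) vertices
  ... | yes uS | yes dom = yes (uS , λ w → All.lookup dom (vertices-complete w))
  ... | yes _  | no ¬dom = no λ (_ , dom) → ¬dom (All.tabulate λ {w} _ → dom w)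
  ... | no ¬uS | _       = no λ (uS , _) → ¬uS uS

  gamma-exists : ∀ adjW k S₀ → IsKTupleTDS adjW k S₀ → Σ ℕ (IsGammaKT adjW k)
  gamma-exists adjW k S₀ tds₀ = length best , (best , best-TDS , refl) , best-minimal
    where
    candidates : List (List W)
    candidates = filter (isTDS? adjW k) (sublists vertices)

    best : List W
    best = argmin length (normalise S₀) candidates

    best-TDS : IsKTupleTDS adjW k best
    best-TDS = argmin-all length {normalise S₀} {candidates} (normalise-TDS adjW k S₀ tds₀)
      (All.tabulate λ c∈ → proj₂ (∈-filter⁻ (isTDS? adjW k) {xs = sublists vertices} c∈))

    best-minimal : ∀ S → IsKTupleTDS adjW k S → length best ≤ length S
    best-minimal S tds = subst (length best ≤_) (normalise-length S (proj₁ tds))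
      (All.lookup (f[argmin]≤f[xs] {f = length} (normalise S₀) candidates)
        (∈-filter⁺ (isTDS? adjW k) {xs = sublists vertices} (filter-∈-sublists _ vertices) (normalise-TDS adjW k S tds)))

gamma-≤ : ∀ {W : Set} {adjW : W → W → Bool} {k a n} → IsGammaKT adjW k a →
          Σ[ S ∈ List W ] (IsKTupleTDS adjW k S × length S ≤ n) → a ≤ n
gamma-≤ (_ , minimal) (S , tds , |S|≤n) = ≤-trans (minimal S tds) |S|≤n

-- The inflated graph of a graph with adjacency adjV on a vertex type with
-- decidable equality.  A vertex x = x_i x_j of G_I has an owner x_i (it lies
-- in the clique X_i) and a target x_j.
module Inflation {V : Set} (_≟_ : DecidableEquality V) (adjV : V → V → Bool) where

  Vertex : Set
  Vertex = IV adjV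

  owner target : Vertex → V
  owner  x = proj₁ (proj₁ x)
  target x = proj₂ (proj₁ x)

  vertex-≡ : ∀ {x y : Vertex} → owner x ≡ owner y → target x ≡ target y → x ≡ y
  vertex-≡ {(i , j) , e} {(.i , .j) , e′} refl refl = cong ((i , j) ,_) (T-irrelevant e e′)

  _≟ᵛ_ : DecidableEquality Vertex
  _≟ᵛ_ = Σ-≡-dec (Σ-≡-dec _≟_ _≟_) (λ e e′ → yes (T-irrelevant e e′))

  infl : Vertex → Vertex → Bool
  infl = inflAdj _≟_ adjV

  infl-cases : ∀ x y → T (infl x y) →
               (owner x ≡ owner y × target x ≢ target y) ⊎ (owner y ≡ target x × target y ≡ owner x)
  infl-cases x y xy with owner x ≟ owner y | target x ≟ target y | owner x ≟ target y | target x ≟ owner y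
  ... | yes o≡ | no t≢ | _      | _      = inj₁ (o≡ , t≢)
  ... | yes _  | yes _ | yes a  | yes b  = inj₂ (sym b , sym a)
  ... | no _   | _     | yes a  | yes b  = inj₂ (sym b , sym a)

  clique-edge : ∀ {x y} → owner x ≡ owner y → target x ≢ target y → T (infl x y)
  clique-edge {x} {y} o≡ t≢ with owner x ≟ owner y | target x ≟ target y
  ... | yes _ | no _  = tt
  ... | no o≢ | _     = ⊥-elim (o≢ o≡)
  ... | yes _ | yes t≡ = ⊥-elim (t≢ t≡)

  inClique : V → Vertex → Bool
  inClique c x = ⌊ owner x ≟ c ⌋

  clique-adjacent : ∀ c {x y} → T (inClique c x) → T (inClique c y) → y ≢ x → T (infl x y)
  clique-adjacent c {x} {y} cx cy y≢x =
    clique-edge {x} {y} (trans (toWitness cx) (sym (toWitness cy)))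
                        (λ t≡ → y≢x (vertex-≡ (trans (toWitness cy) (sym (toWitness cx))) (sym t≡)))

  mates : V → Vertex → Vertex → Bool
  mates c x = except _≟ᵛ_ (inClique c) x

  mates-adjacent : ∀ c {x y} → T (inClique c x) → T (mates c x y) → T (infl x y)
  mates-adjacent c cx my = let cy , y≢x = except-elim _≟ᵛ_ (inClique c) my in clique-adjacent c cx cy y≢x

  -- All neighbours of x ∈ X_c are clique mates, except one: its partner across
  -- the edge replacing x_i x_j.
  neighbours-≤ : ∀ c x S → Unique S → T (inClique c x) → count (infl x) S ≤ suc (count (mates c x) S)
  neighbours-≤ c x S uS cx = begin
    count (infl x) S                                  ≤⟨ count-mono _ _ S classify ⟩
    count (λ t → mates c x t ∨ partner t) S            ≤⟨ count-∨ _ _ S ⟩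
    count (mates c x) S + count partner S              ≤⟨ +-monoʳ-≤ _ (count-≤1 partner S uS partner-unique) ⟩
    count (mates c x) S + 1                            ≡⟨ +-comm _ 1 ⟩
    suc (count (mates c x) S)                          ∎
    where
    open ≤-Reasoning
    partner : Vertex → Bool
    partner t = ⌊ (owner t ≟ target x) ×-dec (target t ≟ owner x) ⌋
    partner-unique : ∀ t t′ → T (partner t) → T (partner t′) → t ≡ t′
    partner-unique t t′ pt pt′ = let o , τ = toWitness pt ; o′ , τ′ = toWitness pt′ in
      vertex-≡ (trans o (sym o′)) (trans τ (sym τ′))
    classify : ∀ t → t ∈ S → T (infl x t) → T (mates c x t ∨ partner t)
    classify t _ xt = T-∨-intro (mates c x t) (Sum.map mate fromWitness (infl-cases x t xt))
      where
      mate : owner x ≡ owner t × target x ≢ target t → T (mates c x t)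
      mate (o≡ , t≢) = except-intro _≟ᵛ_ (inClique c) (fromWitness (trans (sym o≡) (toWitness cx)))
                                                  (λ t≡x → t≢ (cong target (sym t≡x)))

  asVertex : V × V → Maybe Vertex
  asVertex (i , j) with T? (adjV i j)
  ... | yes e = just ((i , j) , e)
  ... | no  _ = nothing

  asVertex-complete : ∀ x → MaybeAny.Any (x ≡_) (asVertex (proj₁ x))
  asVertex-complete ((i , j) , e) with T? (adjV i j)
  ... | yes e′ = MaybeAny.just (cong ((i , j) ,_) (T-irrelevant e e′))
  ... | no ¬e  = ⊥-elim (¬e e)

  vertexList : List V → List Vertex
  vertexList vs = mapMaybe asVertex (cartesianProduct vs vs)

  vertexList-complete : ∀ vs → (∀ v → v ∈ vs) → ∀ x → x ∈ vertexList vs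
  vertexList-complete vs complete x@((i , j) , _) =
    mapMaybe⁺ asVertex (cartesianProduct vs vs)
      (map⁺ (Any.map (λ { refl → asVertex-complete x })
                     (∈-cartesianProduct⁺ (complete i) (complete j))))

δ≤degree : ∀ {n} (X : Graph (Fin (suc n))) c → δ X ≤ degree X c
δ≤degree X c = minOver-≤ (degree X) c
  where
  minOver-≤ : ∀ {n} (f : Fin (suc n) → ℕ) i → minOver f ≤ f i
  minOver-≤ {zero}  f Fin.zero    = ≤-refl
  minOver-≤ {suc n} f Fin.zero    = m⊓n≤m _ _
  minOver-≤ {suc n} f (Fin.suc i) = ≤-trans (m⊓n≤n _ _) (minOver-≤ (f ∘ Fin.suc) i)

module InflatedGraph {n} (X : Graph (Fin (suc n))) where
  open Inflation Fin._≟_ (adj X) public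
  open FiniteMinimum _≟ᵛ_ (vertexList (allFin _)) (vertexList-complete (allFin _) ∈-allFin) public

  -- A duplicate-free list containing the whole clique X_c has at least deg(c) members in it:
  -- the targets of these members are exactly the neighbours of c.
  clique-size : ∀ c L → Unique L → (∀ t → T (inClique c t) → t ∈ L) → degree X c ≤ count (inClique c) L
  clique-size c L uL covers = begin
    degree X c
      ≤⟨ unique-⊆-length _ _ (Unique.filter⁺ (T? ∘ adj X c) (Unique.allFin⁺ _)) neighbour-is-target ⟩
    length (map target (filterᵇ (inClique c) L))  ≡⟨ length-map target (filterᵇ (inClique c) L) ⟩
    count (inClique c) L                          ∎
    where
    open ≤-Reasoning
    neighbour-is-target : ∀ j → j ∈ filterᵇ (adj X c) (allFin _) → j ∈ map target (filterᵇ (inClique c) L)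
    neighbour-is-target j j∈ =
      let cj = proj₂ (∈-filter⁻ (T? ∘ adj X c) {xs = allFin _} j∈)
          c-in-clique = fromWitness {a? = c Fin.≟ c} refl
      in ∈-map⁺ target (∈-filter⁺ (T? ∘ inClique c) (covers ((c , j) , cj) c-in-clique) c-in-clique)

  module _ (k : ℕ) (k<δ : k < δ X) where

    -- A duplicate-free list containing the whole clique X_c dominates each x ∈ X_c
    -- k times: it has more than k members in X_c, all adjacent to x except x itself.
    clique-dominated : ∀ c x L → Unique L → (∀ t → T (inClique c t) → t ∈ L) → T (inClique c x) →
                       k ≤ count (infl x) L
    clique-dominated c x L uL covers cx = ≤-pred (begin
      suc k                         ≤⟨ ≤-trans k<δ (δ≤degree X c) ⟩
      degree X c                    ≤⟨ clique-size c L uL covers ⟩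
      count (inClique c) L          ≤⟨ count-except-≤ _≟ᵛ_ (inClique c) x L uL ⟩
      suc (count (mates c x) L)     ≤⟨ s≤s (count-mono _ _ L λ _ _ → mates-adjacent c cx) ⟩
      suc (count (infl x) L)        ∎)
      where open ≤-Reasoning

    vertices-TDS : IsKTupleTDS infl k vertices
    vertices-TDS = vertices-unique , λ x →
      clique-dominated (owner x) x vertices vertices-unique (λ t _ → vertices-complete t) (fromWitness refl)

    -- For k ≥ 2 every k-tuple total dominating set S meets every clique X_c in at
    -- least k vertices: some s ∈ S ∩ X_c exists (a member of X_c has ≥ 2 neighbours
    -- in S, at most one outside X_c), and s has ≥ k neighbours in S, all in X_c but one.
    TDS-meets-clique : 2 ≤ k → ∀ c S → IsKTupleTDS infl k S → k ≤ count (inClique c) S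
    TDS-meets-clique 2≤k c S (uS , dom) = begin
      k                             ≤⟨ dom s ⟩
      count (infl s) S              ≤⟨ neighbours-≤ c s S uS cs ⟩
      suc (count (mates c s) S)     ≤⟨ count-except-< _≟ᵛ_ (inClique c) s S uS s∈S cs ⟩
      count (inClique c) S          ∎
      where
      open ≤-Reasoning
      neighbour : Σ[ j ∈ Fin (suc n) ] (j ∈ allFin _ × T (adj X c j))
      neighbour = count-witness (adj X c) (allFin _) (≤-trans (s≤s z≤n) (≤-trans k<δ (δ≤degree X c)))
      x₀ : Vertex
      x₀ = (c , proj₁ neighbour) , proj₂ (proj₂ neighbour)
      cx₀ : T (inClique c x₀)
      cx₀ = fromWitness refl
      mate-of-x₀ : Σ[ s ∈ Vertex ] (s ∈ S × T (mates c x₀ s))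
      mate-of-x₀ = count-witness (mates c x₀) S
        (≤-pred (≤-trans 2≤k (≤-trans (dom x₀) (neighbours-≤ c x₀ S uS cx₀))))
      s : Vertex
      s = proj₁ mate-of-x₀
      s∈S : s ∈ S
      s∈S = proj₁ (proj₂ mate-of-x₀)
      cs : T (inClique c s)
      cs = proj₁ (except-elim _≟ᵛ_ (inClique c) (proj₂ (proj₂ mate-of-x₀)))

    module _ (c : Fin (suc n)) (S : List Vertex) (uS : Unique S)
             (far  : ∀ x → ¬ T (inClique c x) → k ≤ count (infl x) S)
             (near : ∀ x → k ≤ suc (count (infl x) S)) where

      -- Adding two further members of X_c repairs the deficit inside X_c: every
      -- x ∈ X_c is adjacent to at least one of them.
      add-two-mates : ∀ d₁ d₂ → d₁ ≢ d₂ → d₁ ∉ S → d₂ ∉ S → T (inClique c d₁) → T (inClique c d₂) →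
                      IsKTupleTDS infl k (d₁ ∷ d₂ ∷ S)
      add-two-mates d₁ d₂ d₁≢d₂ d₁∉S d₂∉S cd₁ cd₂ =
          ((d₁≢d₂ ∷ ¬Any⇒All¬ S d₁∉S) ∷ ¬Any⇒All¬ S d₂∉S ∷ uS) , dominated
        where
        adjacent-to-one : ∀ x → T (inClique c x) → 1 ≤ count (infl x) (d₁ ∷ d₂ ∷ [])
        adjacent-to-one x cx with d₁ ≟ᵛ x
        ... | yes refl = count-≥1 (infl x) _ (there (here refl)) (clique-adjacent c cx cd₂ (d₁≢d₂ ∘ sym))
        ... | no d₁≢x  = count-≥1 (infl x) _ (here refl) (clique-adjacent c cx cd₁ d₁≢x)
        dominated : ∀ x → k ≤ count (infl x) (d₁ ∷ d₂ ∷ S)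
        dominated x with T? (inClique c x)
        ... | no ¬cx = ≤-trans (far x ¬cx) (count-≤-++ʳ (infl x) (d₁ ∷ d₂ ∷ []) S)
        ... | yes cx = begin
          k                                                 ≤⟨ near x ⟩
          suc (count (infl x) S)                            ≤⟨ +-monoˡ-≤ _ (adjacent-to-one x cx) ⟩
          count (infl x) (d₁ ∷ d₂ ∷ []) + count (infl x) S  ≡⟨ count-++ (infl x) (d₁ ∷ d₂ ∷ []) S ⟨
          count (infl x) (d₁ ∷ d₂ ∷ S)                      ∎
          where open ≤-Reasoning

      -- Adding the members D of X_c missing from S makes the whole clique present,
      -- so X_c is dominated by `clique-dominated`.
      complete-clique : ∀ D → Unique D → (∀ t → t ∈ D → t ∉ S) → (∀ t → T (inClique c t) → t ∈ D ⊎ t ∈ S) →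
                        IsKTupleTDS infl k (D ++ S)
      complete-clique D uD D∩S=∅ covers = uDS , dominated
        where
        uDS : Unique (D ++ S)
        uDS = Unique.++⁺ uD uS λ (t∈D , t∈S) → D∩S=∅ _ t∈D t∈S
        dominated : ∀ x → k ≤ count (infl x) (D ++ S)
        dominated x with T? (inClique c x)
        ... | no ¬cx = ≤-trans (far x ¬cx) (count-≤-++ʳ (infl x) D S)
        ... | yes cx = clique-dominated c x (D ++ S) uDS
                         (λ t ct → [ ∈-++⁺ˡ , ∈-++⁺ʳ D ]′ (covers t ct)) cx

      -- A set dominating every vertex outside X_c k times and every vertex of X_c
      -- k − 1 times extends to a k-tuple total dominating set with at most two more
      -- vertices: add two missing members of X_c, or complete X_c if fewer are missing.
      repair : Σ[ S′ ∈ List Vertex ] (IsKTupleTDS infl k S′ × length S′ ≤ length S + 2)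
      repair = extend missing (Unique.filter⁺ isMissing? vertices-unique) missing-spec missing-covers
        where
        open import Data.List.Membership.DecPropositional _≟ᵛ_ using (_∈?_)
        isMissing? : ∀ t → Dec (owner t ≡ c × t ∉ S)
        isMissing? t = (owner t Fin.≟ c) ×-dec ¬? (t ∈? S)
        missing : List Vertex
        missing = filter isMissing? vertices
        missing-spec : ∀ t → t ∈ missing → T (inClique c t) × t ∉ S
        missing-spec t t∈ = let c≡ , t∉S = proj₂ (∈-filter⁻ isMissing? {xs = vertices} t∈) in fromWitness c≡ , t∉S
        missing-covers : ∀ t → T (inClique c t) → t ∈ missing ⊎ t ∈ S
        missing-covers t ct with t ∈? S
        ... | yes t∈S = inj₂ t∈S
        ... | no  t∉S = inj₁ (∈-filter⁺ isMissing? (vertices-complete t) (toWitness ct , t∉S))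
        extend : ∀ D → Unique D → (∀ t → t ∈ D → T (inClique c t) × t ∉ S) →
                 (∀ t → T (inClique c t) → t ∈ D ⊎ t ∈ S) →
                 Σ[ S′ ∈ List Vertex ] (IsKTupleTDS infl k S′ × length S′ ≤ length S + 2)
        extend (d₁ ∷ d₂ ∷ _) ((d₁≢d₂ ∷ _) ∷ _) spec _ =
          let cd₁ , d₁∉S = spec d₁ (here refl) ; cd₂ , d₂∉S = spec d₂ (there (here refl)) in
          d₁ ∷ d₂ ∷ S , add-two-mates d₁ d₂ d₁≢d₂ d₁∉S d₂∉S cd₁ cd₂ , ≤-reflexive (+-comm 2 _)
        extend [] uD spec covers =
          S , complete-clique [] uD (λ t → proj₂ ∘ spec t) covers , m≤m+n _ _
        extend (d ∷ []) uD spec covers =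
          d ∷ S , complete-clique (d ∷ []) uD (λ t → proj₂ ∘ spec t) covers ,
          ≤-trans (n≤1+n _) (≤-reflexive (+-comm 2 (length S)))

    -- A copy ι of X_I inside a graph on W (in the application F_I) whose only
    -- neighbour outside the copy is a vertex e, adjacent to the copy of X_c;
    -- π is a partial inverse of ι.
    module Embedding (2≤k : 2 ≤ k) (c : Fin (suc n))
      {W : Set} (_≟W_ : DecidableEquality W) (adjW : W → W → Bool)
      (ι : Vertex → W) (π : W → Maybe Vertex) (e : W)
      (π-ι : ∀ x → π (ι x) ≡ just x)
      (π-just : ∀ {w x} → π w ≡ just x → w ≡ ι x)
      (ι-adjacency : ∀ x y → adjW (ι x) (ι y) ≡ infl x y)
      (e-adjacency : ∀ x → T (inClique c x) → T (adjW e (ι x)))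
      (ι-neighbours : ∀ x w → T (adjW (ι x) w) →
                      (Σ[ y ∈ Vertex ] (w ≡ ι y × T (infl x y))) ⊎ (w ≡ e × T (inClique c x)))
      where

      ι-injective : ∀ {x y} → ι x ≡ ι y → x ≡ y
      ι-injective {x} {y} ιx≡ιy = just-injective (trans (sym (π-ι x)) (trans (cong π ιx≡ιy) (π-ι y)))

      image-dominates-copy : ∀ SX → IsKTupleTDS infl k SX → ∀ x → k ≤ count (adjW (ι x)) (map ι SX)
      image-dominates-copy SX (_ , dom) x = begin
        k                                  ≤⟨ dom x ⟩
        count (infl x) SX                  ≤⟨ count-mono _ _ SX (λ y _ → subst T (sym (ι-adjacency x y))) ⟩
        count (adjW (ι x) ∘ ι) SX          ≡⟨ count-map (adjW (ι x)) ι SX ⟨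
        count (adjW (ι x)) (map ι SX)      ∎
        where open ≤-Reasoning

      image-dominates-e : ∀ SX → IsKTupleTDS infl k SX → k ≤ count (adjW e) (map ι SX)
      image-dominates-e SX tds = begin
        k                                  ≤⟨ TDS-meets-clique 2≤k c SX tds ⟩
        count (inClique c) SX              ≤⟨ count-mono _ _ SX (λ y _ → e-adjacency y) ⟩
        count (adjW e ∘ ι) SX              ≡⟨ count-map (adjW e) ι SX ⟨
        count (adjW e) (map ι SX)          ∎
        where open ≤-Reasoning

      restrict : List W → List Vertex
      restrict S = mapMaybe π S

      isE : W → Bool
      isE w = ⌊ w ≟W e ⌋

      restrict-unique : ∀ S → Unique S → Unique (restrict S)
      restrict-unique S uS = mapMaybe-unique π (λ πw πw′ → trans (π-just πw) (sym (π-just πw′))) S uS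

      pulled-back : ∀ x {w y} → w ≡ ι y → T (infl x y) → T (maybe′ (infl x) false (π w))
      pulled-back x {y = y} refl xy = subst (T ∘ maybe′ (infl x) false) (sym (π-ι y)) xy

      module _ (S : List W) (dom : ∀ x → k ≤ count (adjW (ι x)) S) where

        restrict-near : ∀ x → k ≤ count (infl x) (restrict S) + count isE S
        restrict-near x = begin
          k                                                           ≤⟨ dom x ⟩
          count (adjW (ι x)) S                                        ≤⟨ count-mono _ _ S classify ⟩
          count (λ w → maybe′ (infl x) false (π w) ∨ isE w) S         ≤⟨ count-∨ _ _ S ⟩
          count (maybe′ (infl x) false ∘ π) S + count isE S           ≡⟨ cong (_+ count isE S) (count-mapMaybe π (infl x) S) ⟨
          count (infl x) (restrict S) + count isE S                   ∎
          where
          open ≤-Reasoning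
          classify : ∀ w → w ∈ S → T (adjW (ι x) w) → T (maybe′ (infl x) false (π w) ∨ isE w)
          classify w _ xw = T-∨-intro (maybe′ (infl x) false (π w)) (Sum.map
            (λ (y , w≡ιy , xy) → pulled-back x w≡ιy xy) (λ (w≡e , _) → fromWitness w≡e) (ι-neighbours x w xw))

        restrict-far : ∀ x → ¬ T (inClique c x) → k ≤ count (infl x) (restrict S)
        restrict-far x ¬cx = begin
          k                                      ≤⟨ dom x ⟩
          count (adjW (ι x)) S                   ≤⟨ count-mono _ _ S classify ⟩
          count (maybe′ (infl x) false ∘ π) S    ≡⟨ count-mapMaybe π (infl x) S ⟨
          count (infl x) (restrict S)            ∎
          where
          open ≤-Reasoning
          classify : ∀ w → w ∈ S → T (adjW (ι x) w) → T (maybe′ (infl x) false (π w))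
          classify w _ xw with ι-neighbours x w xw
          ... | inj₁ (y , w≡ιy , xy) = pulled-back x w≡ιy xy
          ... | inj₂ (_ , cx)        = ⊥-elim (¬cx cx)

      -- If S dominates every vertex of the copy k times, then X_I has a k-tuple TDS
      -- of size ≤ |restrict S| + 2·[e ∈ S]: if e ∉ S the restriction itself, and
      -- otherwise its repair.
      restriction-TDS : ∀ S → Unique S → (∀ x → k ≤ count (adjW (ι x)) S) →
                        Σ[ S′ ∈ List Vertex ] (IsKTupleTDS infl k S′ × length S′ ≤ length (restrict S) + 2 * count isE S)
      restriction-TDS S uS dom = by-e-count (count isE S) refl (occurrences-≤1 _≟W_ e S uS)
        where
        by-e-count : ∀ m → count isE S ≡ m → m ≤ 1 →
                     Σ[ S′ ∈ List Vertex ] (IsKTupleTDS infl k S′ × length S′ ≤ length (restrict S) + 2 * m)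
        by-e-count 0 e∉S _ =
          restrict S , (restrict-unique S uS , λ x → subst (k ≤_) (lose-nothing x) (restrict-near S dom x)) , m≤m+n _ _
          where
          lose-nothing : ∀ x → count (infl x) (restrict S) + count isE S ≡ count (infl x) (restrict S)
          lose-nothing x = trans (cong (count (infl x) (restrict S) +_) e∉S) (+-identityʳ _)
        by-e-count 1 e∈S _ = repair c (restrict S) (restrict-unique S uS) (restrict-far S dom)
                               λ x → subst (k ≤_) (lose-one x) (restrict-near S dom x)
          where
          lose-one : ∀ x → count (infl x) (restrict S) + count isE S ≡ suc (count (infl x) (restrict S))
          lose-one x = trans (cong (count (infl x) (restrict S) +_) e∈S) (+-comm _ 1)
        by-e-count (suc (suc _)) _ (s≤s ())

-- The arithmetic closing the lower bound: with x, y the sizes of the two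
-- restrictions and e, f ≤ 1 the numbers of edge vertices used,
-- a + b ≤ (x + y + e + f) + (e + f) ≤ c + 2.
lower-bound-arith : ∀ {a b c x y e f} → a ≤ x + 2 * e → b ≤ y + 2 * f → x + y + e + f ≤ c →
                    e ≤ 1 → f ≤ 1 → a + b ∸ 2 ≤ c
lower-bound-arith {a} {b} {c} {x} {y} {e} {f} a≤ b≤ parts≤c e≤1 f≤1 = begin
  a + b ∸ 2                              ≤⟨ ∸-monoˡ-≤ 2 a+b≤c+2 ⟩
  c + 2 ∸ 2                              ≡⟨ m+n∸n≡m c 2 ⟩
  c                                      ∎
  where
  open ≤-Reasoning
  regroup : ∀ x y e f → x + 2 * e + (y + 2 * f) ≡ (x + y + e + f) + (e + f)
  regroup = solve-∀
  a+b≤c+2 : a + b ≤ c + 2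
  a+b≤c+2 = begin
    a + b                                ≤⟨ +-mono-≤ a≤ b≤ ⟩
    x + 2 * e + (y + 2 * f)              ≡⟨ regroup x y e f ⟩
    (x + y + e + f) + (e + f)            ≤⟨ +-mono-≤ parts≤c (+-mono-≤ e≤1 f≤1) ⟩
    c + 2                                ∎

module CutEdge {m p} (G : Graph (Fin (suc m))) (H : Graph (Fin (suc p)))
               (u : Fin (suc m)) (v : Fin (suc p)) where

  open Inflation (⊎-≡-dec Fin._≟_ Fin._≟_) (FAdj G H u v) public
  module GI = InflatedGraph G
  module HI = InflatedGraph H

  cross-edge : ∀ {a b} → T (⌊ a Fin.≟ u ⌋ ∧ ⌊ b Fin.≟ v ⌋) → a ≡ u × b ≡ v
  cross-edge {a} q = let a≟u , b≟v = Equivalence.to (T-∧ {⌊ a Fin.≟ u ⌋}) q in toWitness a≟u , toWitness b≟v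

  uv-edge : T (⌊ u Fin.≟ u ⌋ ∧ ⌊ v Fin.≟ v ⌋)
  uv-edge = Equivalence.from (T-∧ {⌊ u Fin.≟ u ⌋}) (fromWitness refl , fromWitness refl)

  eu ev : Vertex
  eu = (inj₁ u , inj₂ v) , uv-edge
  ev = (inj₂ v , inj₁ u) , uv-edge

  eu-unique : ∀ {a b} (q : T (FAdj G H u v (inj₁ a) (inj₂ b))) → ((inj₁ a , inj₂ b) , q) ≡ eu
  eu-unique q = let a≡u , b≡v = cross-edge q in vertex-≡ (cong inj₁ a≡u) (cong inj₂ b≡v)

  ev-unique : ∀ {a b} (q : T (FAdj G H u v (inj₂ b) (inj₁ a))) → ((inj₂ b , inj₁ a) , q) ≡ ev
  ev-unique q = let a≡u , b≡v = cross-edge q in vertex-≡ (cong inj₂ b≡v) (cong inj₁ a≡u)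

  ιG : GI.Vertex → Vertex
  ιG ((i , j) , q) = (inj₁ i , inj₁ j) , q

  ιH : HI.Vertex → Vertex
  ιH ((i , j) , q) = (inj₂ i , inj₂ j) , q

  πG : Vertex → Maybe GI.Vertex
  πG ((inj₁ i , inj₁ j) , q) = just ((i , j) , q)
  πG ((inj₁ i , inj₂ j) , q) = nothing
  πG ((inj₂ i , _)      , q) = nothing

  πH : Vertex → Maybe HI.Vertex
  πH ((inj₂ i , inj₂ j) , q) = just ((i , j) , q)
  πH ((inj₂ i , inj₁ j) , q) = nothing
  πH ((inj₁ i , _)      , q) = nothing

  πG-just : ∀ {w x} → πG w ≡ just x → w ≡ ιG x
  πG-just {(inj₁ i , inj₁ j) , q} refl = refl

  πH-just : ∀ {w x} → πH w ≡ just x → w ≡ ιH x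
  πH-just {(inj₂ i , inj₂ j) , q} refl = refl

  ≟-inj₁ : ∀ (a b : Fin (suc m)) →
           ⌊ map′ (cong (inj₁ {B = Fin (suc p)})) inj₁-injective (a Fin.≟ b) ⌋ ≡ ⌊ a Fin.≟ b ⌋
  ≟-inj₁ a b = ⌊⌋-map′ _ _ (a Fin.≟ b)

  ≟-inj₂ : ∀ (a b : Fin (suc p)) →
           ⌊ map′ (cong (inj₂ {A = Fin (suc m)})) inj₂-injective (a Fin.≟ b) ⌋ ≡ ⌊ a Fin.≟ b ⌋
  ≟-inj₂ a b = ⌊⌋-map′ _ _ (a Fin.≟ b)

  ιG-adjacency : ∀ x y → infl (ιG x) (ιG y) ≡ GI.infl x y
  ιG-adjacency ((i , j) , _) ((a , b) , _) rewrite ≟-inj₁ i a | ≟-inj₁ j b | ≟-inj₁ i b | ≟-inj₁ j a = refl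

  ιH-adjacency : ∀ x y → infl (ιH x) (ιH y) ≡ HI.infl x y
  ιH-adjacency ((i , j) , _) ((a , b) , _) rewrite ≟-inj₂ i a | ≟-inj₂ j b | ≟-inj₂ i b | ≟-inj₂ j a = refl

  eu-adjacency : ∀ x → T (GI.inClique u x) → T (infl eu (ιG x))
  eu-adjacency x ux = clique-edge {eu} {ιG x} (cong inj₁ (sym (toWitness ux))) λ ()

  ev-adjacency : ∀ x → T (HI.inClique v x) → T (infl ev (ιH x))
  ev-adjacency x vx = clique-edge {ev} {ιH x} (cong inj₂ (sym (toWitness vx))) λ ()

  ιG-neighbours : ∀ x w → T (infl (ιG x) w) →
                  (Σ[ y ∈ GI.Vertex ] (w ≡ ιG y × T (GI.infl x y))) ⊎ (w ≡ eu × T (GI.inClique u x))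
  ιG-neighbours x ((inj₁ a , inj₁ b) , q) xw =
    inj₁ (((a , b) , q) , refl , subst T (ιG-adjacency x ((a , b) , q)) xw)
  ιG-neighbours x w@((inj₁ a , inj₂ b) , q) xw with infl-cases (ιG x) w xw
  ... | inj₁ (refl , _) = inj₂ (eu-unique q , fromWitness (proj₁ (cross-edge q)))
  ... | inj₂ (_ , ())
  ιG-neighbours x w@((inj₂ a , _) , q) xw with infl-cases (ιG x) w xw
  ... | inj₁ (() , _)
  ... | inj₂ (() , _)

  ιH-neighbours : ∀ x w → T (infl (ιH x) w) →
                  (Σ[ y ∈ HI.Vertex ] (w ≡ ιH y × T (HI.infl x y))) ⊎ (w ≡ ev × T (HI.inClique v x))
  ιH-neighbours x ((inj₂ a , inj₂ b) , q) xw =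
    inj₁ (((a , b) , q) , refl , subst T (ιH-adjacency x ((a , b) , q)) xw)
  ιH-neighbours x w@((inj₂ b , inj₁ a) , q) xw with infl-cases (ιH x) w xw
  ... | inj₁ (refl , _) = inj₂ (ev-unique q , fromWitness (proj₂ (cross-edge q)))
  ... | inj₂ (_ , ())
  ιH-neighbours x w@((inj₁ a , _) , q) xw with infl-cases (ιH x) w xw
  ... | inj₁ (() , _)
  ... | inj₂ (() , _)

  F-vertices : List (Fin (suc m) ⊎ Fin (suc p))
  F-vertices = map inj₁ (allFin _) ++ map inj₂ (allFin _)

  F-vertices-complete : ∀ w → w ∈ F-vertices
  F-vertices-complete (inj₁ i) = ∈-++⁺ˡ (∈-map⁺ inj₁ (∈-allFin i))
  F-vertices-complete (inj₂ j) = ∈-++⁺ʳ (map inj₁ (allFin _)) (∈-map⁺ inj₂ (∈-allFin j))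

  open FiniteMinimum _≟ᵛ_ (vertexList F-vertices) (vertexList-complete F-vertices F-vertices-complete)
    public using (gamma-exists)

  module Bounds (k : ℕ) (2≤k : 2 ≤ k) (k<δG : k < δ G) (k<δH : k < δ H) where

    module SideG = GI.Embedding k k<δG 2≤k u _≟ᵛ_ infl ιG πG eu
                     (λ _ → refl) πG-just ιG-adjacency eu-adjacency ιG-neighbours
    module SideH = HI.Embedding k k<δH 2≤k v _≟ᵛ_ infl ιH πH ev
                     (λ _ → refl) πH-just ιH-adjacency ev-adjacency ιH-neighbours

    union-TDS : ∀ SG SH → IsKTupleTDS GI.infl k SG → IsKTupleTDS HI.infl k SH →
                IsKTupleTDS infl k (map ιG SG ++ map ιH SH)
    union-TDS SG SH tdsG tdsH = unique , dominated
      where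
      L R : List Vertex
      L = map ιG SG
      R = map ιH SH
      unique : Unique (L ++ R)
      unique = Unique.++⁺ (Unique.map⁺ SideG.ι-injective (proj₁ tdsG))
                          (Unique.map⁺ SideH.ι-injective (proj₁ tdsH)) apart
        where
        apart : ∀ {w} → ¬ (w ∈ L × w ∈ R)
        apart (w∈L , w∈R) with ∈-map⁻ ιG w∈L | ∈-map⁻ ιH w∈R
        ... | _ , _ , refl | _ , _ , ()
      dominated : ∀ w → k ≤ count (infl w) (L ++ R)
      dominated ((inj₁ a , inj₁ b) , q) =
        ≤-trans (SideG.image-dominates-copy SG tdsG ((a , b) , q)) (count-≤-++ˡ _ L R)
      dominated ((inj₂ a , inj₂ b) , q) =
        ≤-trans (SideH.image-dominates-copy SH tdsH ((a , b) , q)) (count-≤-++ʳ _ L R)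
      dominated ((inj₁ a , inj₂ b) , q) = subst (λ w → k ≤ count (infl w) (L ++ R)) (sym (eu-unique {a} {b} q))
        (≤-trans (SideG.image-dominates-e SG tdsG) (count-≤-++ˡ _ L R))
      dominated ((inj₂ b , inj₁ a) , q) = subst (λ w → k ≤ count (infl w) (L ++ R)) (sym (ev-unique {a} {b} q))
        (≤-trans (SideH.image-dominates-e SH tdsH) (count-≤-++ʳ _ L R))

    partition : ∀ S → length (SideG.restrict S) + length (SideH.restrict S) + count SideG.isE S + count SideH.isE S
                      ≤ length S
    partition S = begin
      length (SideG.restrict S) + length (SideH.restrict S) + count isEu S + count isEv S
        ≡⟨ cong₂ (λ x y → x + y + count isEu S + count isEv S) (length-mapMaybe πG S) (length-mapMaybe πH S) ⟩
      count inG S + count inH S + count isEu S + count isEv S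
        ≤⟨ +-monoˡ-≤ _ (+-monoˡ-≤ _ (count-disjoint inG inH S G-H)) ⟩
      count (λ w → inG w ∨ inH w) S + count isEu S + count isEv S
        ≤⟨ +-monoˡ-≤ _ (count-disjoint _ isEu S λ w → copies-eu w) ⟩
      count (λ w → (inG w ∨ inH w) ∨ isEu w) S + count isEv S
        ≤⟨ count-disjoint _ isEv S (λ w → others-ev w) ⟩
      count (λ w → ((inG w ∨ inH w) ∨ isEu w) ∨ isEv w) S
        ≤⟨ count-≤-length _ S ⟩
      length S ∎
      where
      open ≤-Reasoning
      inG inH isEu isEv : Vertex → Bool
      inG = is-just ∘ πG
      inH = is-just ∘ πH
      isEu = SideG.isE
      isEv = SideH.isE
      G-H : ∀ w → T (inG w) → ¬ T (inH w)
      G-H ((inj₁ a , inj₁ b) , q) _ ()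
      copies-eu : ∀ w → T (inG w ∨ inH w) → ¬ T (isEu w)
      copies-eu w w∈ w≡eu = subst (λ z → T (inG z ∨ inH z)) (toWitness w≡eu) w∈
      others-ev : ∀ w → T ((inG w ∨ inH w) ∨ isEu w) → ¬ T (isEv w)
      others-ev w w∈ w≡ev = subst (λ z → T ((inG z ∨ inH z) ∨ isEu z)) (toWitness w≡ev) w∈

    upper-bound : ∀ {c} → IsGammaKT infl k c → ∀ SG SH → IsKTupleTDS GI.infl k SG → IsKTupleTDS HI.infl k SH →
                  c ≤ length SG + length SH
    upper-bound (_ , minimal) SG SH tdsG tdsH = begin
      _                                  ≤⟨ minimal _ (union-TDS SG SH tdsG tdsH) ⟩
      length (map ιG SG ++ map ιH SH)    ≡⟨ length-++ (map ιG SG) ⟩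
      length (map ιG SG) + length (map ιH SH) ≡⟨ cong₂ _+_ (length-map ιG SG) (length-map ιH SH) ⟩
      length SG + length SH              ∎
      where open ≤-Reasoning

    lower-bound : ∀ {a b} → IsGammaKT GI.infl k a → IsGammaKT HI.infl k b → ∀ S → IsKTupleTDS infl k S →
                  a + b ∸ 2 ≤ length S
    lower-bound γG γH S (uS , dom) =
      lower-bound-arith {x = length (SideG.restrict S)} {y = length (SideH.restrict S)}
        (gamma-≤ γG (SideG.restriction-TDS S uS (dom ∘ ιG)))
        (gamma-≤ γH (SideH.restriction-TDS S uS (dom ∘ ιH)))
        (partition S) (occurrences-≤1 _≟ᵛ_ eu S uS) (occurrences-≤1 _≟ᵛ_ ev S uS)

theorem3p2 : ∀ {m p} (G : Graph (Fin (suc m))) (H : Graph (Fin (suc p)))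
               (u : Fin (suc m)) (v : Fin (suc p)) →
               Connected G → Connected H →
               (k : ℕ) → 2 ≤ k → k < δ G ⊓ δ H →
               Σ[ a ∈ ℕ ] Σ[ b ∈ ℕ ] Σ[ c ∈ ℕ ]
                 (IsGammaKT (inflated G) k a × IsGammaKT (inflated H) k b ×
                  IsGammaKT (inflatedF G H u v) k c ×
                  (a + b ∸ 2 ≤ c) × (c ≤ a + b))
theorem3p2 G H u v _ _ k 2≤k k<δ =
  let open CutEdge G H u v
      k<δG = ≤-trans k<δ (m⊓n≤m _ _)
      k<δH = ≤-trans k<δ (m⊓n≤n _ _)
      open Bounds k 2≤k k<δG k<δH
      a , γG = GI.gamma-exists GI.infl k GI.vertices (GI.vertices-TDS k k<δG)
      b , γH = HI.gamma-exists HI.infl k HI.vertices (HI.vertices-TDS k k<δH)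
      (SG , tdsG , |SG|≡a) , _ = γG
      (SH , tdsH , |SH|≡b) , _ = γH
      c , γF = gamma-exists infl k _ (union-TDS SG SH tdsG tdsH)
      (S , tdsS , |S|≡c) , _ = γF
  in a , b , c , γG , γH , γF ,
     subst (a + b ∸ 2 ≤_) |S|≡c (lower-bound γG γH S tdsS) ,
     subst₂ (λ x y → c ≤ x + y) |SG|≡a |SH|≡b (upper-bound γF SG SH tdsG tdsH)
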